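{- Let $\mathbf{T}$ be a triangulation of a once-punctured disk with puncture $p$ and $n$ boundary marked points, $i\in\mathbf{T}$ an arc incident to $p$, and $(\tilde{\mathbf{S}}_i,\tilde{\mathbf{T}})$ the associated triangulated $(2n+2)$-gon with vertices $w_0=p,w_1,\dots,w_{2n+1}$ and frieze $\mathfrak{F}_{\tilde{\mathbf{T}}}$ of type $A_{2n-1}$. For every $j\in\mathbf{T}\setminus\{i\}$ (viewed as the arc $j\in\tilde{\mathbf{T}}$ in the copy with vertices $w_0,w_1,\dots,w_{n+1}$): (a) the entry $1_j$ lies in $\mathcal{R}\cup\mathcal{A}$; (b) the entry $2_j$ lies in $\mathcal{R}\cup\mathcal{A}$.
   Context: Triangulations are ideal (self-folded triangles allowed). Type $A_m$ frieze: rows $0,1$, $m$ nontrivial rows of positive integers, rows $1,0$, offset by half steps, diamond rule $bc-ad=1$. For a triangulated polygon with vertices $w_0,\dots,w_{N-1}$ (indices mod $N$), the frieze of type $A_{N-3}$ has first nontrivial row the quiddity sequence (number of triangles at each vertex); its entries are indexed by positions $(s,t)$ with $2\le t-s\le N-2$, the entry at $(s,t)$ lying in nontrivial row $t-s-1$ and corresponding to the diagonal $w_sw_t$ (the quiddity entry at $w_k$ sits at $(k-1,k+1)$, and $(s,t)\to(s,t+1)$, $(s,t)\to(s+1,t)$ are the two diagonal steps to the row below, resp. above, respectively); an entry equals $1$ iff its diagonal is in the triangulation, and equals $2$ iff its diagonal crosses exactly one arc of the triangulation. For $j$ in the triangulation, $1_j$ denotes the entry $1$ corresponding to $j$ and $2_j$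 the entry $2$ corresponding to the diagonal $j'$ obtained by flipping $j$ (the unique diagonal crossing only $j$). Construction: label boundary points of the punctured disk $1,\dots,n$ counterclockwise, $1$ the boundary endpoint of $i$. Cutting along $i$ gives a polygon $\mathbf{S}_i$ with vertices $x,2,\dots,n,y,p$ counterclockwise ($x,y$ copies of $1$), triangulated by $\mathbf{T}\setminus\{i\}$. $\tilde{\mathbf{S}}_i$ is the $(2n+2)$-gon glued from two copies of $\mathbf{S}_i$ via $p\mapsto w_0,x\mapsto w_1,k\mapsto w_k,y\mapsto w_{n+1}$ (arc images labelled $\gamma$) and $p\mapsto w_0,x\mapsto w_{n+1},k\mapsto w_{n+k},y\mapsto w_{2n+1}$ (arc images labelled $\hat\gamma$), and $\tilde{\mathbf{T}}$ consists of all these images together with the diameter $i=w_0w_{n+1}$. In $\mathfrak{F}_{\tilde{\mathbf{T}}}$, $\mathcal{A}$ is the triangular region of positions $(s,t)$ with $1\le s<t\le n+1$, $t-s\ge 2$ (the $n-1$ rows below the quiddity entries at $w_2,\dots,w_n$), and $\mathcal{R}$ is the sectional path of positions $(0,2),(0,3),\dots,(0,n)$, i.e. the entries of the diagonals $w_0w_2,\dots,w_0w_n$. -}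

module Defs where

open import Data.Nat using (ℕ; zero; suc; _+_; _*_; _≤_; _<_)
open import Data.Integer as ℤ using (ℤ; +_)
open import Data.Product using (Σ; _×_; _,_)
open import Data.Sum using (_⊎_)
open import Data.Empty using (⊥)
open import Data.List using (List)
open import Data.List.Membership.Propositional using (_∈_)
open import Relation.Binary.PropositionalEquality using (_≡_; _≢_)
open import Relation.Nullary using (¬_)

-- Arcs of the once-punctured disk with n boundary marked points,
-- labelled 1,…,n counterclockwise, puncture p.
--
--  rad b    : the arc joining boundary point b to the puncture p.
--  arc a k  : the arc not incident to p starting at boundary point a and
--             cutting off (on the side not containing p) the k boundary
--             segments from a counterclockwise to a+k (mod n).
--             k = n is the loop at a enclosing p; k = 1 would be a
--             boundary segment, hence excluded.

data PArc : Set where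
  rad : ℕ → PArc
  arc : ℕ → ℕ → PArc

ValidPArc : ℕ → PArc → Set
ValidPArc n (rad b)   = 1 ≤ b × b ≤ n
ValidPArc n (arc a k) = (1 ≤ a × a ≤ n) × (2 ≤ k × k ≤ n)

Interleave : ℕ → ℕ → ℕ → ℕ → Set
Interleave x y z w = x < y × y < z × z < w

-- boundary point b (or its lift b+n) lies strictly inside the
-- interval [a, a+k] cut off by arc a k
StrictInside : ℕ → ℕ → ℕ → ℕ → Set
StrictInside n a k b = (a < b × b < a + k) ⊎ (a < n + b × n + b < a + k)

PCross : ℕ → PArc → PArc → Set
PCross n (rad b)   (rad c)   = ⊥
PCross n (rad b)   (arc a k) = StrictInside n a k b
PCross n (arc a k) (rad b)   = StrictInside n a k b
PCross n (arc a k) (arc b l) =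
  (Interleave a b (a + k) (b + l) ⊎ Interleave a (n + b) (a + k) (n + b + l))
  ⊎ (Interleave b a (b + l) (a + k) ⊎ Interleave b (n + a) (b + l) (n + a + k))

IsPTriangulation : ℕ → List PArc → Set
IsPTriangulation n T =
  (∀ α → α ∈ T → ValidPArc n α)
  × (∀ α β → α ∈ T → β ∈ T → ¬ PCross n α β)
  × (∀ α → ValidPArc n α → (∀ β → β ∈ T → ¬ PCross n α β) → α ∈ T)

-- Cutting along i = rad 1.  Vertices of S_i : p ↦ 0, x ↦ 1, k ↦ k (2≤k≤n),
-- y ↦ n+1.  The first copy in the (2n+2)-gon uses the same indices
-- (p ↦ w_0, x ↦ w_1, k ↦ w_k, y ↦ w_{n+1}); a diagonal is a pair (s , t)
-- with s < t meaning w_s w_t.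

cut : PArc → ℕ × ℕ
cut (rad b)   = (0 , b)
cut (arc a k) = (a , a + k)

-- second copy: p ↦ w_0, x ↦ w_{n+1}, k ↦ w_{n+k}, y ↦ w_{2n+1}
hat : ℕ → ℕ × ℕ → ℕ × ℕ
hat n (zero  , t) = (0 , n + t)
hat n (suc s , t) = (n + suc s , n + t)

InTildeT : ℕ → List PArc → ℕ × ℕ → Set
InTildeT n T d =
  (d ≡ (0 , n + 1))
  ⊎ Σ PArc (λ γ → γ ∈ T × γ ≢ rad 1 × (d ≡ cut γ ⊎ d ≡ hat n (cut γ)))

Diagonal : ℕ → ℕ × ℕ → Set
Diagonal N (s , t) = s + 2 ≤ t × t < N × (s ≡ 0 → t + 2 ≤ N)

Cross : ℕ × ℕ → ℕ × ℕ → Set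
Cross (s , t) (u , v) = Interleave s u t v ⊎ Interleave u s v t

IsFlip : ℕ → (ℕ × ℕ → Set) → ℕ × ℕ → ℕ × ℕ → Set
IsFlip N Tt j d = Diagonal N d × Cross j d × (∀ e → Tt e → Cross e d → e ≡ j)

-- Positions of the frieze of type A_{N-3}: (s , t) ∈ ℤ² with
-- 2 ≤ t - s ≤ N - 2; the entry there corresponds to the diagonal
-- w_{s mod N} w_{t mod N}.

FriezePos : ℕ → ℤ × ℤ → Set
FriezePos N (s , t) = s ℤ.+ + 2 ℤ.≤ t × t ℤ.+ + 2 ℤ.≤ s ℤ.+ + N

EntryOf : ℕ → ℕ × ℕ → ℤ × ℤ → Set
EntryOf N (u , v) (s , t) =
  Σ ℤ λ k → (s ≡ + u ℤ.+ k ℤ.* + N × t ≡ + v ℤ.+ k ℤ.* + N)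
          ⊎ (s ≡ + v ℤ.+ k ℤ.* + N × t ≡ + u ℤ.+ (k ℤ.+ + 1) ℤ.* + N)

RegionR : ℕ → ℤ × ℤ → Set
RegionR n (s , t) = s ≡ + 0 × + 2 ℤ.≤ t × t ℤ.≤ + n

RegionA : ℕ → ℤ × ℤ → Set
RegionA n (s , t) = + 1 ℤ.≤ s × s ℤ.+ + 2 ℤ.≤ t × t ℤ.≤ + (n + 1)

RegionRA : ℕ → ℤ × ℤ → Set
RegionRA n p = RegionR n p ⊎ RegionA n p

EntryLiesIn : ℕ → (ℤ × ℤ → Set) → ℕ × ℕ → Set
EntryLiesIn N Reg d = Σ (ℤ × ℤ) λ q → FriezePos N q × EntryOf N d q × Reg q

module Submission where

-- Cutting the disk along i = rad 1 gives the polygon S_i with vertices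
-- 0 (= p), 1, …, n, L = n + 1, the first half of S̃_i, cut off by the diameter
-- w₀ w_{n+1}.
-- Then 1_j sits at the position of cut j, and 2_j at that of its flip, which
-- cannot cross the diameter and hence is again strictly inside it.

open import Defs
open import Data.Nat
open import Data.Nat.Properties
open import Data.Integer using (+_; +≤+)
open import Data.Product using (Σ; _×_; _,_; proj₁; proj₂)
open import Data.Product.Properties using (≡-dec)
open import Data.Sum using (_⊎_; inj₁; inj₂; [_,_]′)
open import Data.Empty using (⊥-elim)
open import Data.List using (List)
open import Data.List.Relation.Unary.Any using (Any; any?)
open import Data.List.Membership.Propositional using (_∈_; find; lose)
open import Relation.Nullary using (¬_; Dec; yes; no)
open import Relation.Nullary.Decidable using (_×-dec_; _⊎-dec_)
open import Relation.Binary.PropositionalEquality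
open import Relation.Binary using (tri<; tri≈; tri>)

≤⇒<+1 : ∀ {m n} → m ≤ n → m < n + 1
≤⇒<+1 {m} {n} m≤n = subst (m <_) (+-comm 1 n) (s≤s m≤n)

<+1⇒≤ : ∀ {m n} → m < n + 1 → m ≤ n
<+1⇒≤ {m} {n} m<n+1 = m<1+n⇒m≤n (subst (m <_) (+-comm n 1) m<n+1)

<⇒+2≤ : ∀ {u v} → suc u < v → u + 2 ≤ v
<⇒+2≤ {u} {v} u+1<v = subst (_≤ v) (+-comm 2 u) u+1<v

cross-sym : ∀ {e f} → Cross e f → Cross f e
cross-sym {_ , _} {_ , _} (inj₁ i) = inj₂ i
cross-sym {_ , _} {_ , _} (inj₂ i) = inj₁ i

side-crosses-nothing : ∀ k e → ¬ Cross (k , suc k) e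
side-crosses-nothing k (x , y) (inj₁ (k<x , x<k+1 , _)) = <⇒≱ k<x (m<1+n⇒m≤n x<k+1)
side-crosses-nothing k (x , y) (inj₂ (_ , k<y , y<k+1)) = <⇒≱ k<y (m<1+n⇒m≤n y<k+1)

closing-crosses-nothing : ∀ L x y → y ≤ L → ¬ Cross (0 , L) (x , y)
closing-crosses-nothing L x y y≤L (inj₁ (_ , _ , L<y)) = <⇒≱ L<y y≤L
closing-crosses-nothing L x y y≤L (inj₂ (() , _))

_⊏_ : ℕ × ℕ → ℕ × ℕ → Set
(u , v) ⊏ (a , b) = a ≤ u × v ≤ b × (a < u ⊎ v < b)

⊏-irrefl : ∀ {e} → ¬ (e ⊏ e)
⊏-irrefl {a , b} (_ , _ , inj₁ a<a) = <-irrefl refl a<a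
⊏-irrefl {a , b} (_ , _ , inj₂ b<b) = <-irrefl refl b<b

⊏-gap : ∀ {s t a b} → s < t → (s , t) ⊏ (a , b) → suc a < b
⊏-gap s<t (a≤s , t≤b , inj₁ a<s) = <-≤-trans (≤-<-trans a<s s<t) t≤b
⊏-gap s<t (a≤s , t≤b , inj₂ t<b) = ≤-<-trans (≤-<-trans a≤s s<t) t<b

-- Strict enclosure decreases the width b ∸ a; this bounds the descent in apexAbove.
⊏-narrower : ∀ {u v a b} f → (u , v) ⊏ (a , b) → b ≤ a + suc f → v ≤ u + f
⊏-narrower {a = a} {b} f (a≤u , v≤b , inj₁ a<u) b≤ =
  ≤-trans v≤b (≤-trans (subst (b ≤_) (+-suc a f) b≤) (+-monoˡ-≤ f a<u))
⊏-narrower {a = a} {b} f (a≤u , v≤b , inj₂ v<b) b≤ =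
  ≤-trans (≤-pred (≤-trans v<b (subst (b ≤_) (+-suc a f) b≤))) (+-monoˡ-≤ f a≤u)

crossing-stays-inside : ∀ {L s t u v} → t ≤ L → Cross (s , t) (u , v)
                      → ¬ Cross (0 , L) (u , v) → (u , v) ⊏ (0 , L)
crossing-stays-inside {u = u} t≤L (inj₁ (s<u , u<t , t<v)) avoids =
  z≤n , ≮⇒≥ (λ L<v → avoids (inj₁ (0<u , <-≤-trans u<t t≤L , L<v))) , inj₁ 0<u
  where
  0<u : 0 < u
  0<u = ≤-<-trans z≤n s<u
crossing-stays-inside {L} {v = v} t≤L (inj₂ (u<s , s<v , v<t)) avoids = z≤n , <⇒≤ v<L , inj₂ v<L
  where
  v<L : v < L
  v<L = <-≤-trans v<t t≤L

module TriangulatedPolygon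
  (L : ℕ) (E : ℕ × ℕ → Set) (E? : ∀ u v → Dec (E (u , v)))
  (E-bounded : ∀ {u v} → E (u , v) → u < v × v ≤ L)
  (E-side : ∀ k → suc k ≤ L → E (k , suc k))
  (E-closing : E (0 , L))
  (E-noncrossing : ∀ {e f} → E e → E f → ¬ Cross e f)
  (E-maximal : ∀ u v → suc u < v → v ≤ L → (∀ e → E e → ¬ Cross e (u , v)) → E (u , v))
  where

  LastNeighbour : ℕ → ℕ → Set
  LastNeighbour s t =
    Σ ℕ λ m → s < m × m < t × E (s , m) × (∀ x → m < x → x < t → ¬ E (s , x))

  -- Scanning down from k finds the last neighbour, at the latest at the side (s , s+1).
  scanDown : ∀ s t k → t ≤ L → s < k → k < t
           → (∀ x → k < x → x < t → ¬ E (s , x)) → LastNeighbour s t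
  scanDown s t (suc k) t≤L s<k+1 k+1<t none with E? s (suc k)
  ... | yes e = suc k , s<k+1 , k+1<t , e , none
  ... | no ¬e with m≤n⇒m<n∨m≡n s<k+1
  ...   | inj₂ refl = ⊥-elim (¬e (E-side s (≤-trans (<⇒≤ k+1<t) t≤L)))
  ...   | inj₁ s+1<k+1 = scanDown s t k t≤L (≤-pred s+1<k+1) (<-trans (n<1+n k) k+1<t) none′
    where
    none′ : ∀ x → k < x → x < t → ¬ E (s , x)
    none′ x k<x x<t with m≤n⇒m<n∨m≡n k<x
    ... | inj₁ k+1<x = none x k+1<x x<t
    ... | inj₂ refl = ¬e

  -- Every diagonal (s , t) bounds a triangle (s , m , t) on its inner side: m is the
  -- last neighbour of s, and (m , t) is forced into E by maximality.
  apexBelow : ∀ {s t} → E (s , t) → suc s < t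
            → Σ ℕ λ m → s < m × m < t × E (s , m) × E (m , t)
  apexBelow {s} {suc k} est s+1<t
    with scanDown s (suc k) k (proj₂ (E-bounded est)) (≤-pred s+1<t) (n<1+n k)
                  (λ x k<x x<k+1 → ⊥-elim (<⇒≱ k<x (m<1+n⇒m≤n x<k+1)))
  ... | m , s<m , m<t , esm , last = m , s<m , m<t , esm , emt
    where
    uncrossed : ∀ e → E e → ¬ Cross e (m , suc k)
    uncrossed (x , y) exy (inj₁ (x<m , m<y , y<t)) with <-cmp x s
    ... | tri< x<s _ _ = E-noncrossing exy est (inj₁ (x<s , <-trans s<m m<y , y<t))
    ... | tri≈ _ refl _ = last y m<y y<t exy
    ... | tri> _ _ s<x = E-noncrossing esm exy (inj₁ (s<x , x<m , m<y))
    uncrossed (x , y) exy (inj₂ (m<x , x<t , t<y)) =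
      E-noncrossing est exy (inj₁ (<-trans s<m m<x , x<t , t<y))

    emt : E (m , suc k)
    emt with m≤n⇒m<n∨m≡n m<t
    ... | inj₂ refl = E-side m (proj₂ (E-bounded est))
    ... | inj₁ m+1<t = E-maximal m (suc k) m+1<t (proj₂ (E-bounded est)) uncrossed

  ApexAbove : ℕ → ℕ → Set
  ApexAbove s t = (Σ ℕ λ m → t < m × E (s , m) × E (t , m))
                ⊎ (Σ ℕ λ m → m < s × E (m , s) × E (m , t))

  -- The apex below a diagonal (a , b) enclosing (s , t) cannot lie strictly
  -- between s and t; so it either completes a triangle over (s , t) or cuts off
  -- a narrower diagonal still enclosing (s , t).
  apexOrNarrower : ∀ {s t a b} → E (s , t) → E (a , b) → (s , t) ⊏ (a , b)
                 → ApexAbove s t ⊎ Σ (ℕ × ℕ) λ e → E e × (s , t) ⊏ e × e ⊏ (a , b)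
  apexOrNarrower {s} {t} {a} {b} est eab (a≤s , t≤b , strict) = fromApex (apexBelow eab a+1<b)
    where
    a+1<b : suc a < b
    a+1<b = ⊏-gap (proj₁ (E-bounded est)) (a≤s , t≤b , strict)

    fromApex : (Σ ℕ λ m → a < m × m < b × E (a , m) × E (m , b))
             → ApexAbove s t ⊎ Σ (ℕ × ℕ) λ e → E e × (s , t) ⊏ e × e ⊏ (a , b)
    fromApex (m , a<m , m<b , eam , emb) with <-cmp m s | <-cmp m t
    ... | tri< m<s _ _ | _ =
      inj₂ ((m , b) , emb , (<⇒≤ m<s , t≤b , inj₁ m<s) , (<⇒≤ a<m , ≤-refl , inj₁ a<m))
    ... | tri≈ _ refl _ | _ with m≤n⇒m<n∨m≡n t≤b
    ...   | inj₁ t<b = inj₂ ((m , b) , emb , (≤-refl , t≤b , inj₂ t<b) , (<⇒≤ a<m , ≤-refl , inj₁ a<m))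
    ...   | inj₂ refl = inj₁ (inj₂ (a , a<m , eam , eab))
    fromApex (m , a<m , m<b , eam , emb) | tri> _ _ s<m | tri< m<t _ _ =
      ⊥-elim ([ (λ a<s → E-noncrossing eam est (inj₁ (a<s , s<m , m<t)))
              , (λ t<b → E-noncrossing est emb (inj₁ (s<m , m<t , t<b))) ]′ strict)
    fromApex (m , a<m , m<b , eam , emb) | tri> _ _ s<m | tri≈ _ refl _ with m≤n⇒m<n∨m≡n a≤s
    ... | inj₁ a<s = inj₂ ((a , m) , eam , (a≤s , ≤-refl , inj₁ a<s) , (≤-refl , <⇒≤ m<b , inj₂ m<b))
    ... | inj₂ refl = inj₁ (inj₁ (b , m<b , eab , emb))
    fromApex (m , a<m , m<b , eam , emb) | tri> _ _ s<m | tri> _ _ t<m =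
      inj₂ ((a , m) , eam , (a≤s , <⇒≤ t<m , inj₂ t<m) , (≤-refl , <⇒≤ m<b , inj₂ m<b))

  -- Every diagonal strictly inside the closing side has a triangle on its outer side:
  -- descend from the closing side through narrower enclosing diagonals.
  apexAbove : ∀ {s t} → E (s , t) → (s , t) ⊏ (0 , L) → ApexAbove s t
  apexAbove {s} {t} est enclosed = descend L E-closing enclosed ≤-refl
    where
    descend : ∀ {a b} f → E (a , b) → (s , t) ⊏ (a , b) → b ≤ a + f → ApexAbove s t
    descend {a} {b} zero eab (a≤s , t≤b , _) b≤a+0 =
      ⊥-elim (<⇒≱ (≤-<-trans a≤s (<-≤-trans (proj₁ (E-bounded est)) t≤b))
                  (subst (b ≤_) (+-identityʳ a) b≤a+0))
    descend (suc f) eab st⊏ab b≤ with apexOrNarrower est eab st⊏ab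
    ... | inj₁ apex = apex
    ... | inj₂ (_ , ee , st⊏e , e⊏ab) = descend f ee st⊏e (⊏-narrower f e⊏ab b≤)

  record Quadrilateral (q₀ q₁ q₂ q₃ : ℕ) : Set where
    constructor quadrilateral
    field
      q₀<q₁ : q₀ < q₁
      q₁<q₂ : q₁ < q₂
      q₂<q₃ : q₂ < q₃
      side₀₁ : E (q₀ , q₁)
      side₁₂ : E (q₁ , q₂)
      side₂₃ : E (q₂ , q₃)
      side₀₃ : E (q₀ , q₃)

  onlyCrosser₁₃ : ∀ {q₀ q₁ q₂ q₃} → Quadrilateral q₀ q₁ q₂ q₃
                → ∀ e → E e → Cross e (q₁ , q₃) → e ≡ (q₀ , q₂)
  onlyCrosser₁₃ {q₀} {q₁} {q₂} {q₃} Q = crosser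
    where
    open Quadrilateral Q
    crosser : ∀ e → E e → Cross e (q₁ , q₃) → e ≡ (q₀ , q₂)
    crosser (x , y) exy (inj₁ (x<q₁ , q₁<y , y<q₃)) with <-cmp y q₂ | <-cmp x q₀
    ... | tri< y<q₂ _ _ | _ = ⊥-elim (E-noncrossing exy side₁₂ (inj₁ (x<q₁ , q₁<y , y<q₂)))
    ... | tri> _ _ q₂<y | _ =
      ⊥-elim (E-noncrossing exy side₂₃ (inj₁ (<-trans x<q₁ q₁<q₂ , q₂<y , y<q₃)))
    ... | tri≈ _ refl _ | tri< x<q₀ _ _ =
      ⊥-elim (E-noncrossing exy side₀₃ (inj₁ (x<q₀ , <-trans q₀<q₁ q₁<y , y<q₃)))
    ... | tri≈ _ refl _ | tri≈ _ refl _ = refl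
    ... | tri≈ _ refl _ | tri> _ _ q₀<x = ⊥-elim (E-noncrossing side₀₁ exy (inj₁ (q₀<x , x<q₁ , q₁<y)))
    crosser (x , y) exy (inj₂ (q₁<x , x<q₃ , q₃<y)) =
      ⊥-elim (E-noncrossing side₀₃ exy (inj₁ (<-trans q₀<q₁ q₁<x , x<q₃ , q₃<y)))

  onlyCrosser₀₂ : ∀ {q₀ q₁ q₂ q₃} → Quadrilateral q₀ q₁ q₂ q₃
                → ∀ e → E e → Cross e (q₀ , q₂) → e ≡ (q₁ , q₃)
  onlyCrosser₀₂ {q₀} {q₁} {q₂} {q₃} Q = crosser
    where
    open Quadrilateral Q
    crosser : ∀ e → E e → Cross e (q₀ , q₂) → e ≡ (q₁ , q₃)
    crosser (x , y) exy (inj₁ (x<q₀ , q₀<y , y<q₂)) =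
      ⊥-elim (E-noncrossing exy side₀₃ (inj₁ (x<q₀ , q₀<y , <-trans y<q₂ q₂<q₃)))
    crosser (x , y) exy (inj₂ (q₀<x , x<q₂ , q₂<y)) with <-cmp x q₁ | <-cmp y q₃
    ... | tri< x<q₁ _ _ | _ =
      ⊥-elim (E-noncrossing side₀₁ exy (inj₁ (q₀<x , x<q₁ , <-trans q₁<q₂ q₂<y)))
    ... | tri> _ _ q₁<x | _ = ⊥-elim (E-noncrossing side₁₂ exy (inj₁ (q₁<x , x<q₂ , q₂<y)))
    ... | tri≈ _ refl _ | tri< y<q₃ _ _ =
      ⊥-elim (E-noncrossing exy side₂₃ (inj₁ (x<q₂ , q₂<y , y<q₃)))
    ... | tri≈ _ refl _ | tri≈ _ refl _ = refl
    ... | tri≈ _ refl _ | tri> _ _ q₃<y =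
      ⊥-elim (E-noncrossing side₀₃ exy (inj₁ (q₀<x , <-trans x<q₂ q₂<q₃ , q₃<y)))

  FlipOf : ℕ → ℕ → ℕ × ℕ → Set
  FlipOf s t (u , v) = suc u < v × v ≤ L × Cross (s , t) (u , v)
                     × (∀ e → E e → Cross e (u , v) → e ≡ (s , t))

  -- A diagonal strictly inside the closing side has a flip: the other diagonal of
  -- the quadrilateral formed by its triangles below and above.
  flipExists : ∀ {s t} → E (s , t) → suc s < t → (s , t) ⊏ (0 , L) → Σ (ℕ × ℕ) (FlipOf s t)
  flipExists est s+1<t enclosed with apexBelow est s+1<t | apexAbove est enclosed
  ... | m , s<m , m<t , esm , emt | inj₁ (m′ , t<m′ , esm′ , etm′) =
    (m , m′) , ≤-<-trans m<t t<m′ , proj₂ (E-bounded esm′) , inj₁ (s<m , m<t , t<m′) ,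
    onlyCrosser₁₃ (quadrilateral s<m m<t t<m′ esm emt etm′ esm′)
  ... | m , s<m , m<t , esm , emt | inj₂ (m′ , m′<s , em′s , em′t) =
    (m′ , m) , ≤-<-trans m′<s s<m , <⇒≤ (<-≤-trans m<t (proj₂ (E-bounded est))) ,
    inj₂ (m′<s , s<m , m<t) , onlyCrosser₀₂ (quadrilateral m′<s s<m m<t em′s esm emt em′t)

cut-reflects-crossing : ∀ n γ δ → Cross (cut γ) (cut δ) → PCross n γ δ
cut-reflects-crossing n (rad b) (rad c) (inj₁ (() , _))
cut-reflects-crossing n (rad b) (rad c) (inj₂ (() , _))
cut-reflects-crossing n (rad b) (arc a k) (inj₁ (_ , a<b , b<a+k)) = inj₁ (a<b , b<a+k)
cut-reflects-crossing n (rad b) (arc a k) (inj₂ (() , _))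
cut-reflects-crossing n (arc a k) (rad b) (inj₁ (() , _))
cut-reflects-crossing n (arc a k) (rad b) (inj₂ (_ , a<b , b<a+k)) = inj₁ (a<b , b<a+k)
cut-reflects-crossing n (arc a k) (arc b l) (inj₁ i) = inj₁ (inj₁ i)
cut-reflects-crossing n (arc a k) (arc b l) (inj₂ i) = inj₂ (inj₁ i)

module CutDisk (n : ℕ) (T : List PArc) (isT : IsPTriangulation n T) (i∈T : rad 1 ∈ T) where

  L : ℕ
  L = n + 1

  valid : ∀ α → α ∈ T → ValidPArc n α
  valid = proj₁ isT

  compatible : ∀ α β → α ∈ T → β ∈ T → ¬ PCross n α β
  compatible = proj₁ (proj₂ isT)

  maximal : ∀ α → ValidPArc n α → (∀ β → β ∈ T → ¬ PCross n α β) → α ∈ T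
  maximal = proj₂ (proj₂ isT)

  beyondL : ∀ {b x} → 1 ≤ b → n + b < x → ¬ (x ≤ L)
  beyondL 1≤b n+b<x x≤L = <-irrefl refl (≤-<-trans (+-monoʳ-≤ n 1≤b) (<-≤-trans n+b<x x≤L))

  -- α is an arc of S_i: it does not pass over the boundary point 1 where we cut.
  InS : PArc → Set
  InS (rad b) = 1 ≤ b
  InS (arc a k) = 1 ≤ a × a + k ≤ L

  -- Arcs of T are compatible with i = rad 1, hence lie in S_i.
  T-inS : ∀ γ → γ ∈ T → InS γ
  T-inS (rad b) γ∈T = proj₁ (valid _ γ∈T)
  T-inS (arc a k) γ∈T = proj₁ (proj₁ (valid _ γ∈T)) , ≮⇒≥ crossesI
    where
    crossesI : ¬ (L < a + k)
    crossesI L<a+k = compatible _ _ γ∈T i∈T (inj₂ (≤⇒<+1 (proj₂ (proj₁ (valid _ γ∈T))) , L<a+k))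

  cut-preserves-crossing : ∀ α β → InS α → InS β → PCross n α β → Cross (cut α) (cut β)
  cut-preserves-crossing (rad b) (arc c l) _ (1≤c , _) (inj₁ (c<b , b<c+l)) = inj₁ (1≤c , c<b , b<c+l)
  cut-preserves-crossing (rad b) (arc c l) 1≤b (_ , c+l≤L) (inj₂ (_ , n+b<c+l)) = ⊥-elim (beyondL 1≤b n+b<c+l c+l≤L)
  cut-preserves-crossing (arc a k) (rad b) (1≤a , _) _ (inj₁ (a<b , b<a+k)) = inj₂ (1≤a , a<b , b<a+k)
  cut-preserves-crossing (arc a k) (rad b) (_ , a+k≤L) 1≤b (inj₂ (_ , n+b<a+k)) = ⊥-elim (beyondL 1≤b n+b<a+k a+k≤L)
  cut-preserves-crossing (arc a k) (arc b l) _ _ (inj₁ (inj₁ i)) = inj₁ i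
  cut-preserves-crossing (arc a k) (arc b l) (_ , a+k≤L) (1≤b , _) (inj₁ (inj₂ (_ , n+b<a+k , _))) =
    ⊥-elim (beyondL 1≤b n+b<a+k a+k≤L)
  cut-preserves-crossing (arc a k) (arc b l) _ _ (inj₂ (inj₁ i)) = inj₂ i
  cut-preserves-crossing (arc a k) (arc b l) (1≤a , _) (_ , b+l≤L) (inj₂ (inj₂ (_ , n+a<b+l , _))) =
    ⊥-elim (beyondL 1≤a n+a<b+l b+l≤L)

  cut-ordered : ∀ γ → ValidPArc n γ → proj₁ (cut γ) < proj₂ (cut γ)
  cut-ordered (rad b) (1≤b , _) = 1≤b
  cut-ordered (arc a k) (_ , 2≤k , _) = m<m+n a (≤-trans (s≤s z≤n) 2≤k)

  cut-diagonal : ∀ γ → ValidPArc n γ → γ ≢ rad 1 → suc (proj₁ (cut γ)) < proj₂ (cut γ)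
  cut-diagonal (rad b) (1≤b , _) γ≢i with m≤n⇒m<n∨m≡n 1≤b
  ... | inj₁ 1<b = 1<b
  ... | inj₂ refl = ⊥-elim (γ≢i refl)
  cut-diagonal (arc a k) (_ , 2≤k , _) _ = subst (_≤ a + k) (+-comm a 2) (+-monoʳ-≤ a 2≤k)

  cut-enclosed : ∀ γ → ValidPArc n γ → InS γ → cut γ ⊏ (0 , L)
  cut-enclosed (rad b) (_ , b≤n) _ = z≤n , ≤-trans b≤n (m≤m+n n 1) , inj₂ (≤⇒<+1 b≤n)
  cut-enclosed (arc (suc a) k) _ (_ , a+k≤L) = z≤n , a+k≤L , inj₁ (s≤s z≤n)

  chordPreimage : ∀ u v → suc u < v → v ≤ L
                → (u , v) ≡ (0 , L) ⊎ Σ PArc λ α → ValidPArc n α × InS α × cut α ≡ (u , v)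
  chordPreimage zero v 1<v v≤L with v ≟ L
  ... | yes refl = inj₁ refl
  ... | no v≢L = inj₂ (rad v , (1≤v , <+1⇒≤ (≤∧≢⇒< v≤L v≢L)) , 1≤v , refl)
    where
    1≤v : 1 ≤ v
    1≤v = <⇒≤ 1<v
  chordPreimage (suc u) v u+1<v v≤L with m≤n⇒∃[o]m+o≡n (<⇒≤ (<-trans (n<1+n (suc u)) u+1<v))
  ... | k , refl = inj₂ (arc (suc u) k , ((s≤s z≤n , a≤n) , (2≤k , k≤n)) , (s≤s z≤n , v≤L) , refl)
    where
    2≤k : 2 ≤ k
    2≤k = +-cancelˡ-≤ (suc u) 2 k (subst (_≤ suc u + k) (+-comm 2 (suc u)) u+1<v)
    a≤n : suc u ≤ n
    a≤n = <+1⇒≤ (<-≤-trans (m<m+n (suc u) (<-≤-trans (s≤s z≤n) 2≤k)) v≤L)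
    k≤n : k ≤ n
    k≤n = ≤-trans (m≤n+m k u) (<+1⇒≤ v≤L)

  E : ℕ × ℕ → Set
  E (u , v) = (v ≡ suc u × v ≤ L) ⊎ (u , v) ≡ (0 , L) ⊎ Any (λ γ → cut γ ≡ (u , v)) T

  E? : ∀ u v → Dec (E (u , v))
  E? u v = ((v ≟ suc u) ×-dec (v ≤? L)) ⊎-dec ≡-dec _≟_ _≟_ (u , v) (0 , L)
           ⊎-dec any? (λ γ → ≡-dec _≟_ _≟_ (cut γ) (u , v)) T

  E-bounded : ∀ {u v} → E (u , v) → u < v × v ≤ L
  E-bounded (inj₁ (refl , v≤L)) = ≤-refl , v≤L
  E-bounded (inj₂ (inj₁ refl)) = ≤⇒<+1 z≤n , ≤-refl
  E-bounded (inj₂ (inj₂ γ-in)) with find γ-in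
  ... | γ , γ∈T , refl = cut-ordered γ (valid γ γ∈T) , proj₁ (proj₂ (cut-enclosed γ (valid γ γ∈T) (T-inS γ γ∈T)))

  E-side : ∀ k → suc k ≤ L → E (k , suc k)
  E-side k k+1≤L = inj₁ (refl , k+1≤L)

  E-closing : E (0 , L)
  E-closing = inj₂ (inj₁ refl)

  E-noncrossing : ∀ {e f} → E e → E f → ¬ Cross e f
  E-noncrossing {u , _} {f} (inj₁ (refl , _)) _ = side-crosses-nothing u f
  E-noncrossing {e} {x , _} _ (inj₁ (refl , _)) c = side-crosses-nothing x e (cross-sym c)
  E-noncrossing {f = x , y} (inj₂ (inj₁ refl)) ef = closing-crosses-nothing L x y (proj₂ (E-bounded ef))
  E-noncrossing {u , v} ee (inj₂ (inj₁ refl)) c = closing-crosses-nothing L u v (proj₂ (E-bounded ee)) (cross-sym c)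
  E-noncrossing (inj₂ (inj₂ γ-in)) (inj₂ (inj₂ δ-in)) c with find γ-in | find δ-in
  ... | γ , γ∈T , refl | δ , δ∈T , refl = compatible γ δ γ∈T δ∈T (cut-reflects-crossing n γ δ c)

  E-maximal : ∀ u v → suc u < v → v ≤ L → (∀ e → E e → ¬ Cross e (u , v)) → E (u , v)
  E-maximal u v u+1<v v≤L uncrossed with chordPreimage u v u+1<v v≤L
  ... | inj₁ refl = E-closing
  ... | inj₂ (α , α-valid , α-inS , refl) = inj₂ (inj₂ (lose (maximal α α-valid compatibleα) refl))
    where
    compatibleα : ∀ β → β ∈ T → ¬ PCross n α β
    compatibleα β β∈T pc = uncrossed (cut β) (inj₂ (inj₂ (lose β∈T refl)))
      (cross-sym (cut-preserves-crossing α β α-inS (T-inS β β∈T) pc))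

  open TriangulatedPolygon L E E? E-bounded E-side E-closing E-noncrossing E-maximal public

  hat-disjoint : ∀ γ → InS γ → ∀ {x y} → x < y → y ≤ L → ¬ Cross (hat n (cut γ)) (x , y)
  hat-disjoint (rad b) 1≤b _ y≤L (inj₁ (_ , _ , n+b<y)) = beyondL 1≤b n+b<y y≤L
  hat-disjoint (rad b) _ _ _ (inj₂ (() , _))
  hat-disjoint (arc (suc a) k) _ x<y y≤L (inj₁ (n+a<x , _)) = beyondL (s≤s z≤n) (<-trans n+a<x x<y) y≤L
  hat-disjoint (arc (suc a) k) _ _ y≤L (inj₂ (_ , n+a<y , _)) = beyondL (s≤s z≤n) n+a<y y≤L

  T̃-crossing⇒E : ∀ e {x y} → InTildeT n T e → x < y → y ≤ L → Cross e (x , y) → E e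
  T̃-crossing⇒E _ (inj₁ refl) _ _ _ = E-closing
  T̃-crossing⇒E _ (inj₂ (γ , γ∈T , _ , inj₁ refl)) _ _ _ = inj₂ (inj₂ (lose γ∈T refl))
  T̃-crossing⇒E _ (inj₂ (γ , γ∈T , _ , inj₂ refl)) x<y y≤L c = ⊥-elim (hat-disjoint γ (T-inS γ γ∈T) x<y y≤L c)

firstCopy-room : ∀ {n v} → 1 ≤ n → v ≤ n + 1 → v + 2 ≤ 2 * n + 2
firstCopy-room {n} 1≤n v≤L =
  +-monoˡ-≤ 2 (≤-trans v≤L (≤-trans (+-monoʳ-≤ n 1≤n) (≤-reflexive (cong (λ m → n + m) (sym (+-identityʳ n))))))

firstCopy-diagonal : ∀ {n u v} → 1 ≤ n → suc u < v → v ≤ n + 1 → Diagonal (2 * n + 2) (u , v)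
firstCopy-diagonal {v = v} 1≤n u+1<v v≤L =
  <⇒+2≤ u+1<v , <-≤-trans (m<m+n v (s≤s z≤n)) (firstCopy-room 1≤n v≤L) , λ _ → firstCopy-room 1≤n v≤L

firstCopy-region : ∀ {n u v} → suc u < v → (u , v) ⊏ (0 , n + 1) → RegionRA n (+ u , + v)
firstCopy-region {u = zero} _ (_ , _ , inj₁ ())
firstCopy-region {u = zero} 1<v (_ , _ , inj₂ v<L) = inj₁ (refl , +≤+ 1<v , +≤+ (<+1⇒≤ v<L))
firstCopy-region {u = suc u} u+1<v (_ , v≤L , _) = inj₂ (+≤+ (s≤s z≤n) , +≤+ (<⇒+2≤ u+1<v) , +≤+ v≤L)

firstCopy-entry : ∀ {n u v} → 1 ≤ n → suc u < v → (u , v) ⊏ (0 , n + 1)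
                → EntryLiesIn (2 * n + 2) (RegionRA n) (u , v)
firstCopy-entry {n} {u} {v} 1≤n u+1<v enclosed =
  (+ u , + v) ,
  (+≤+ (<⇒+2≤ u+1<v) , +≤+ (≤-trans (firstCopy-room 1≤n (proj₁ (proj₂ enclosed))) (m≤n+m _ u))) ,
  (+ 0 , inj₁ (cong +_ (sym (+-identityʳ u)) , cong +_ (sym (+-identityʳ v)))) ,
  firstCopy-region u+1<v enclosed

lemma4p4 : (n : ℕ) → 1 ≤ n → (T : List PArc) → IsPTriangulation n T
    → rad 1 ∈ T → (j : PArc) → j ∈ T → j ≢ rad 1
    → EntryLiesIn (2 * n + 2) (RegionRA n) (cut j)
    × (Σ (ℕ × ℕ) (IsFlip (2 * n + 2) (InTildeT n T) (cut j))
    × ((d : ℕ × ℕ) → IsFlip (2 * n + 2) (InTildeT n T) (cut j) d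
    → EntryLiesIn (2 * n + 2) (RegionRA n) d))
lemma4p4 n 1≤n T isT i∈T j j∈T j≢i = firstCopy-entry 1≤n j-diagonal j-enclosed , (flip-2j , entry-2j)
  where
  open CutDisk n T isT i∈T

  j-valid : ValidPArc n j
  j-valid = valid j j∈T

  j-diagonal : suc (proj₁ (cut j)) < proj₂ (cut j)
  j-diagonal = cut-diagonal j j-valid j≢i

  j-enclosed : cut j ⊏ (0 , L)
  j-enclosed = cut-enclosed j j-valid (T-inS j j∈T)

  -- (b) existence: the flip of cut j in S_i is its flip in S̃_i.
  flip-2j : Σ (ℕ × ℕ) (IsFlip (2 * n + 2) (InTildeT n T) (cut j))
  flip-2j with flipExists (inj₂ (inj₂ (lose j∈T refl))) j-diagonal j-enclosed
  ... | (u , v) , u+1<v , v≤L , crosses , unique =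
    (u , v) , firstCopy-diagonal 1≤n u+1<v v≤L , crosses ,
    λ e e∈T̃ c → unique e (T̃-crossing⇒E e e∈T̃ (<-trans (n<1+n u) u+1<v) v≤L c) c

  -- (b) location: a flip cannot cross the diameter, so it stays inside the first copy.
  entry-2j : ∀ d → IsFlip (2 * n + 2) (InTildeT n T) (cut j) d → EntryLiesIn (2 * n + 2) (RegionRA n) d
  entry-2j (u , v) ((u+2≤v , _ , _) , crosses , unique) =
    firstCopy-entry 1≤n (subst (_≤ v) (+-comm u 2) u+2≤v) (crossing-stays-inside (proj₁ (proj₂ j-enclosed)) crosses avoidsDiameter)
    where
    avoidsDiameter : ¬ Cross (0 , L) (u , v)
    avoidsDiameter c = ⊏-irrefl (subst (_⊏ (0 , L)) (sym (unique (0 , L) (inj₁ refl) c)) j-enclosed)
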